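{- Let $p$ be an odd prime and $n\geq 1$ an integer. The $p$-adic Newton polygon of $P(p^n,p^n+1,x)$ consists of a single segment, namely the segment from $\left(0,\frac{p^n-1}{p-1}\right)$ to $(p^n,0)$.
   Context: For positive integers $u,v$ define $P(u,v,x)=\sum_{j=0}^{u}\frac{(u+v-j)!}{v!}\binom{u}{j}x^j$. For $g(x)=\sum_{i=0}^k a_ix^i\in\mathbf{Q}[x]$, the $p$-adic Newton polygon of $g$ is the lower convex hull of the points $(i,v_p(a_i))$, $0\le i\le k$, $a_i\neq 0$, where $v_p$ is the $p$-adic valuation. -}

module Defs where

open import Data.Nat.Base using (ℕ; zero; suc; _+_; _*_; _∸_; _^_; _≤_; _!; _/_)
open import Data.Nat.Properties using ()
open import Data.Nat.Combinatorics using (_C_)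
open import Data.Nat.Divisibility using (_∣_)
open import Data.Product using (_×_)
open import Relation.Nullary using (¬_)

open import Data.Nat.Properties using (_!≢0)
open import Data.Nat.Base using (NonZero)


-- Coefficient of x^j in P(u,v,x) = Σ_{j=0}^{u} ((u+v-j)!/v!) * binom(u,j) * x^j.
-- For j ≤ u the quotient (u+v-j)!/v! is an exact integer division.
-- For j > u the coefficient is 0 (the polynomial has degree u).
P-coeff : (u v j : ℕ) → ℕ
P-coeff u v j = (_/_ ((u + v ∸ j) !) (v !) {{v !≢0}}) * (u C j)

-- p-adic valuation, as a relation: v_p(m) = e  iff  p^e ∣ m and p^(e+1) ∤ m.
-- (For m = 0 no e satisfies this, matching that v_p(0) is not a natural number.)
Valuation : (p m e : ℕ) → Set
Valuation p m e = (p ^ e ∣ m) × ¬ (p ^ suc e ∣ m)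

-- For a polynomial g(x) = Σ_{i=0}^{k} a i x^i with integer coefficients, the
-- p-adic Newton polygon (lower convex hull of the points (i, v_p(a_i)) with a_i ≠ 0)
-- consists of the single segment from (0, y₀) to (k, 0).
-- This holds exactly when (0, y₀) and (k, 0) are points of the set
-- (i.e. v_p(a_0) = y₀ and v_p(a_k) = 0) and every point (i, v_p(a_i)), 0 ≤ i ≤ k,
-- a_i ≠ 0, lies on or above the line through them: v_p(a_i) ≥ y₀ (k - i) / k,
-- written without division as y₀ * (k - i) ≤ k * v_p(a_i).
NewtonPolygonSingleSegment : (p k : ℕ) (a : ℕ → ℕ) (y₀ : ℕ) → Set
NewtonPolygonSingleSegment p k a y₀ =
  Valuation p (a 0) y₀ ×
  Valuation p (a k) 0 ×
  (∀ i e → i ≤ k → Valuation p (a i) e → y₀ * (k ∸ i) ≤ k * e)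

-- (p^n - 1)/(p - 1), defined for p ≥ 2 (exact division); 0 for p < 2 (unused).
geomQuot : (p n : ℕ) → ℕ
geomQuot zero n = 0
geomQuot (suc zero) n = 0
geomQuot (suc (suc q)) n = (suc (suc q) ^ n ∸ 1) / suc q

{-# OPTIONS --safe #-}
module Submission where

open import Defs
open import Data.Nat.Base using (ℕ; _≥_; _^_; _+_)
open import Data.Nat.Primality using (Prime)
open import Relation.Binary.PropositionalEquality using (_≢_)

open import Data.Nat.Base
  using (zero; suc; pred; _*_; _∸_; _≤_; _<_; _≤′_; ≤′-refl; ≤′-step; _!; _/_; _%_;
         z≤n; z<s; s≤s; NonZero; >-nonZero⁻¹; nonTrivial⇒n>1)
open import Data.Nat.Properties
open import Data.Nat.Divisibility
open import Data.Nat.DivMod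
open import Data.Nat.Combinatorics using (_C_; nCk≡nC[n∸k]; nCk≡nPk/k!; nCn≡1)
open import Data.Nat.Combinatorics.Base using (_P′_)
open import Data.Nat.Combinatorics.Specification
  using (nP′k≡n!/[n∸k]!; nPk≡n!/[n∸k]!; nP′k≡n[n∸1P′k∸1]; nP′n≡n!; k!∣nP′k)
open import Data.Nat.Primality using (euclidsLemma; prime⇒nonZero; prime⇒nonTrivial)
open import Data.Nat.Solver using (module +-*-Solver)
open +-*-Solver using (solve; _:+_; _:*_; _:=_; con)
open import Data.Product using (∃-syntax; _×_; _,_)
open import Data.Sum using ([_,_]′; inj₁; inj₂)
open import Function using (_∘_)
open import Relation.Nullary using (yes; no; contradiction)
open import Relation.Binary.PropositionalEquality
  using (_≡_; refl; sym; trans; cong; cong₂; subst; subst₂; module ≡-Reasoning)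

-- Write q = p^n and G = 1 + p + ⋯ + p^(n−1) = (q − 1)/(p − 1). The coefficient
-- a_i = ((2q+1−i)!/(q+1)!)·C(q,i) is a multiple of (q−i)!·C(q,i) = q(q−1)⋯(i+1), and a
-- falling factorial of length j starting at p^n has p-adic valuation at least jG/p^n:
-- its factors divisible by p are p times a falling factorial of length ⌈j/p⌉ starting
-- at p^(n−1). At the ends,
-- a_q = 1, and a_0 = (2q+1)!/(q+1)! has valuation v_p((2q)!) − v_p(q!) = 2G − G by
-- Legendre's formula v_p((c·p^n)!) = cG for c < p, which needs p > 2 for c = 2.

geomSum : ℕ → ℕ → ℕ
geomSum p zero    = 0
geomSum p (suc n) = p ^ n + geomSum p n

geomSum-*-pred : ∀ t n → geomSum (suc t) n * t + 1 ≡ suc t ^ n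
geomSum-*-pred t zero    = refl
geomSum-*-pred t (suc n) = begin
  (P + G) * t + 1     ≡⟨ solve 3 (λ P G t → (P :+ G) :* t :+ con 1 := P :* t :+ (G :* t :+ con 1))
                               refl P G t ⟩
  P * t + (G * t + 1) ≡⟨ cong (P * t +_) (geomSum-*-pred t n) ⟩
  P * t + P           ≡⟨ solve 2 (λ P t → P :* t :+ P := P :+ t :* P) refl P t ⟩
  suc t * P           ∎
  where
  open ≡-Reasoning
  P = suc t ^ n
  G = geomSum (suc t) n

geomQuot≡geomSum : ∀ {p} n → 1 < p → geomQuot p n ≡ geomSum p n
geomQuot≡geomSum {suc zero}    n (s≤s ())
geomQuot≡geomSum {suc (suc t)} n _ = begin
  (suc (suc t) ^ n ∸ 1) / suc t ≡⟨ cong (λ x → (x ∸ 1) / suc t) (sym (geomSum-*-pred (suc t) n)) ⟩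
  (G * suc t + 1 ∸ 1) / suc t   ≡⟨ cong (_/ suc t) (m+n∸n≡m (G * suc t) 1) ⟩
  G * suc t / suc t             ≡⟨ m*n/n≡m G (suc t) ⟩
  G                             ∎
  where
  open ≡-Reasoning
  G = geomSum (suc (suc t)) n

P′-mono-∣ : ∀ n {i j} → i ≤ j → n P′ i ∣ n P′ j
P′-mono-∣ n i≤j = go (≤⇒≤′ i≤j)
  where
  go : ∀ {i j} → i ≤′ j → n P′ i ∣ n P′ j
  go ≤′-refl             = ∣-refl
  go (≤′-step {j} i≤′j) = ∣-trans (go i≤′j) (n∣m*n (n ∸ j))

[m+1+k]P′[1+k]≡[m+1+k]*[m+k]P′k : ∀ m k → (m + suc k) P′ suc k ≡ (m + suc k) * ((m + k) P′ k)
[m+1+k]P′[1+k]≡[m+1+k]*[m+k]P′k m k rewrite +-suc m k = nP′k≡n[n∸1P′k∸1] (suc (m + k)) (suc k)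

[m+k]!≡[m+k]P′k*m! : ∀ m k → (m + k) ! ≡ ((m + k) P′ k) * m !
[m+k]!≡[m+k]P′k*m! m k = begin
  (m + k) !                                 ≡⟨ sym (m/n*n≡m (m≤n⇒m!∣n! (m∸n≤m (m + k) k))) ⟩
  (m + k) ! / (m + k ∸ k) ! * (m + k ∸ k) ! ≡⟨ cong₂ _*_ (sym (nP′k≡n!/[n∸k]! (m≤n+m k m)))
                                                         (cong _! (m+n∸n≡m m k)) ⟩
  ((m + k) P′ k) * m !                      ∎
  where
  open ≡-Reasoning
  instance _ = (m + k ∸ k) !≢0

[n∸k]!*nCk≡nP′[n∸k] : ∀ {n k} → k ≤ n → (n ∸ k) ! * (n C k) ≡ n P′ (n ∸ k)
[n∸k]!*nCk≡nP′[n∸k] {n} {k} k≤n = begin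
  (n ∸ k) ! * (n C k)                      ≡⟨ cong ((n ∸ k) ! *_) (nCk≡nC[n∸k] k≤n) ⟩
  (n ∸ k) ! * (n C (n ∸ k))                ≡⟨ cong ((n ∸ k) ! *_) (nCk≡nPk/k! n∸k≤n) ⟩
  (n ∸ k) ! * ((n P (n ∸ k)) / (n ∸ k) !)  ≡⟨ cong (λ x → (n ∸ k) ! * (x / (n ∸ k) !)) nP≡nP′ ⟩
  (n ∸ k) ! * ((n P′ (n ∸ k)) / (n ∸ k) !) ≡⟨ m*[n/m]≡n (k!∣nP′k n∸k≤n) ⟩
  n P′ (n ∸ k)                             ∎
  where
  open ≡-Reasoning
  open import Data.Nat.Combinatorics using (_P_)
  instance _ = (n ∸ k) !≢0
  n∸k≤n = m∸n≤m n k
  nP≡nP′ : n P (n ∸ k) ≡ n P′ (n ∸ k)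
  nP≡nP′ = trans (nPk≡n!/[n∸k]! n∸k≤n) (sym (nP′k≡n!/[n∸k]! n∸k≤n))

module _ (p : ℕ) .{{_ : NonZero p}} where

  -- Comes from the factors p * Q ∸ p * b (b ≤ a) of the right-hand side.
  p^[1+a]*QP′[1+a]∣[p*Q]P′[1+p*a] : ∀ Q a → p ^ suc a * (Q P′ suc a) ∣ (p * Q) P′ suc (p * a)
  p^[1+a]*QP′[1+a]∣[p*Q]P′[1+p*a] Q zero rewrite *-zeroʳ p =
    ∣-reflexive (solve 2 (λ p Q → (p :* con 1) :* (Q :* con 1) := (p :* Q) :* con 1) refl p Q)
  p^[1+a]*QP′[1+a]∣[p*Q]P′[1+p*a] Q (suc a) = begin
    p ^ suc (suc a) * (Q P′ suc (suc a))
      ≡⟨ solve 4 (λ p P d X → (p :* P) :* (d :* X) := (p :* d) :* (P :* X)) refl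
                 p (p ^ suc a) (Q ∸ suc a) (Q P′ suc a) ⟩
    (p * (Q ∸ suc a)) * (p ^ suc a * (Q P′ suc a))
      ≡⟨ cong (_* (p ^ suc a * (Q P′ suc a))) (*-distribˡ-∸ p Q (suc a)) ⟩
    (p * Q ∸ p * suc a) * (p ^ suc a * (Q P′ suc a))
      ∣⟨ *-monoʳ-∣ (p * Q ∸ p * suc a) (p^[1+a]*QP′[1+a]∣[p*Q]P′[1+p*a] Q a) ⟩
    (p * Q ∸ p * suc a) * ((p * Q) P′ suc (p * a))
      ∣⟨ *-monoʳ-∣ (p * Q ∸ p * suc a) (P′-mono-∣ (p * Q) 1+p*a≤p*[1+a]) ⟩
    (p * Q) P′ suc (p * suc a) ∎
    where
    open ∣-Reasoning
    1+p*a≤p*[1+a] : suc (p * a) ≤ p * suc a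
    1+p*a≤p*[1+a] = ≤-trans (+-monoˡ-≤ (p * a) (>-nonZero⁻¹ p)) (≤-reflexive (sym (*-suc p a)))

  1+m≤p*[1+m/p] : ∀ m → suc m ≤ p * suc (m / p)
  1+m≤p*[1+m/p] m = begin
    suc m                   ≡⟨ cong suc (m≡m%n+[m/n]*n m p) ⟩
    suc (m % p + m / p * p) ≤⟨ +-monoˡ-≤ (m / p * p) (m%n<n m p) ⟩
    p + m / p * p           ≡⟨ cong (p +_) (*-comm (m / p) p) ⟩
    p + p * (m / p)         ≡⟨ sym (*-suc p (m / p)) ⟩
    p * suc (m / p)         ∎
    where open ≤-Reasoning

  [p^n]P′j-valuation-lowerBound : ∀ n j → ∃[ E ] p ^ E ∣ (p ^ n) P′ j × j * geomSum p n ≤ p ^ n * E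
  [p^n]P′j-valuation-lowerBound zero    j       = 0 , 1∣ _ , ≤-reflexive (*-zeroʳ j)
  [p^n]P′j-valuation-lowerBound (suc n) zero    = 0 , 1∣ _ , z≤n
  [p^n]P′j-valuation-lowerBound (suc n) (suc m) with [p^n]P′j-valuation-lowerBound n (suc (m / p))
  ... | E , p^E∣ , c*G≤Q*E = c + E , p^[c+E]∣ , j*G′≤pQ*[c+E]
    where
    Q = p ^ n
    G = geomSum p n
    c = suc (m / p)
    p^[c+E]∣ : p ^ (c + E) ∣ (p * Q) P′ suc m
    p^[c+E]∣ = begin
      p ^ (c + E)            ≡⟨ ^-distribˡ-+-* p c E ⟩
      p ^ c * p ^ E          ∣⟨ *-monoʳ-∣ (p ^ c) p^E∣ ⟩
      p ^ c * (Q P′ c)       ∣⟨ p^[1+a]*QP′[1+a]∣[p*Q]P′[1+p*a] Q (m / p) ⟩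
      (p * Q) P′ suc (p * (m / p))
        ∣⟨ P′-mono-∣ (p * Q) (s≤s (≤-trans (≤-reflexive (*-comm p (m / p))) (m/n*n≤m m p))) ⟩
      (p * Q) P′ suc m       ∎
      where open ∣-Reasoning
    j*G′≤pQ*[c+E] : suc m * (Q + G) ≤ (p * Q) * (c + E)
    j*G′≤pQ*[c+E] = begin
      suc m * (Q + G)             ≤⟨ *-monoˡ-≤ (Q + G) (1+m≤p*[1+m/p] m) ⟩
      (p * c) * (Q + G)           ≡⟨ solve 4 (λ p c Q G → (p :* c) :* (Q :+ G) := p :* Q :* c :+ p :* (c :* G))
                                             refl p c Q G ⟩
      p * Q * c + p * (c * G)     ≤⟨ +-monoʳ-≤ (p * Q * c) (*-monoʳ-≤ p c*G≤Q*E) ⟩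
      p * Q * c + p * (Q * E)     ≡⟨ solve 4 (λ p c Q E → p :* Q :* c :+ p :* (Q :* E) := (p :* Q) :* (c :+ E))
                                             refl p c Q E ⟩
      (p * Q) * (c + E)           ∎
      where open ≤-Reasoning

P-coeff≡P′*C : ∀ {u i} v → i ≤ u → P-coeff u v i ≡ ((v + (u ∸ i)) P′ (u ∸ i)) * (u C i)
P-coeff≡P′*C {u} {i} v i≤u = cong (_* (u C i)) (begin
  (u + v ∸ i) ! / v !        ≡⟨ cong (λ x → x ! / v !) (trans (+-∸-comm v i≤u) (+-comm j v)) ⟩
  (v + j) ! / v !            ≡⟨ cong (_/ v !) ([m+k]!≡[m+k]P′k*m! v j) ⟩
  ((v + j) P′ j) * v ! / v ! ≡⟨ m*n/n≡m ((v + j) P′ j) (v !) ⟩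
  (v + j) P′ j               ∎)
  where
  open ≡-Reasoning
  instance _ = v !≢0
  j = u ∸ i

P-coeff-0 : ∀ u v → P-coeff u v 0 ≡ (v + u) P′ u
P-coeff-0 u v = trans (P-coeff≡P′*C {u} v z≤n) (*-identityʳ ((v + u) P′ u))

P-coeff-top : ∀ u v → P-coeff u v u ≡ 1
P-coeff-top u v = trans (P-coeff≡P′*C {u} v ≤-refl)
  (cong₂ _*_ (cong (λ j → (v + j) P′ j) (n∸n≡0 u)) (nCn≡1 u))

uP′[u∸i]∣P-coeff : ∀ {u i} v → i ≤ u → u P′ (u ∸ i) ∣ P-coeff u v i
uP′[u∸i]∣P-coeff {u} {i} v i≤u = begin
  u P′ (u ∸ i)                        ≡⟨ sym ([n∸k]!*nCk≡nP′[n∸k] i≤u) ⟩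
  (u ∸ i) ! * (u C i)                 ∣⟨ *-monoˡ-∣ (u C i) (k!∣nP′k (m≤n+m (u ∸ i) v)) ⟩
  ((v + (u ∸ i)) P′ (u ∸ i)) * (u C i) ≡⟨ sym (P-coeff≡P′*C v i≤u) ⟩
  P-coeff u v i                       ∎
  where open ∣-Reasoning

^-monoʳ-∣ : ∀ p {a b} → a ≤ b → p ^ a ∣ p ^ b
^-monoʳ-∣ p {a} {b} a≤b = subst (λ x → p ^ a ∣ p ^ x) (m+[n∸m]≡n a≤b)
  (subst (p ^ a ∣_) (sym (^-distribˡ-+-* p a (b ∸ a))) (m∣m*n (p ^ (b ∸ a))))

valuation⇒≤ : ∀ {p m e E} → Valuation p m e → p ^ E ∣ m → E ≤ e
valuation⇒≤ {p} {e = e} {E} (_ , p^[1+e]∤m) p^E∣m with E ≤? e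
... | yes E≤e = E≤e
... | no  E≰e = contradiction (∣-trans (^-monoʳ-∣ p (≰⇒> E≰e)) p^E∣m) p^[1+e]∤m

∣⇒∤+ : ∀ {p m k} → p ∣ m → 0 < k → k < p → p ∤ m + k
∣⇒∤+ {k = suc _} p∣m _ k<p p∣m+k = <⇒≱ k<p (∣⇒≤ (∣m+n∣m⇒∣n p∣m+k p∣m))

-- Unlike Valuation, this keeps the cofactor, so products and quotients are computed directly.
record ExactPower (p e m : ℕ) : Set where
  constructor exact
  field
    unit       : ℕ
    m≡p^e*unit : m ≡ p ^ e * unit
    p∤unit     : p ∤ unit

module _ {p : ℕ} (p-prime : Prime p) where

  private instance
    p-nonZero : NonZero p
    p-nonZero = prime⇒nonZero p-prime

  1<p : 1 < p
  1<p = nonTrivial⇒n>1 p {{prime⇒nonTrivial p-prime}}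

  p∤1 : p ∤ 1
  p∤1 = ∣⇒∤+ (p ∣0) z<s 1<p

  exactPower⇒valuation : ∀ {e m} → ExactPower p e m → Valuation p m e
  exactPower⇒valuation {e} (exact u refl p∤u) =
    divides u (*-comm (p ^ e) u) ,
    λ p^[1+e]∣ → p∤u (*-cancelˡ-∣ (p ^ e) {{m^n≢0 p e}}
                        (subst (_∣ p ^ e * u) (*-comm p (p ^ e)) p^[1+e]∣))

  exactPower-unit : ∀ {u} → p ∤ u → ExactPower p 0 u
  exactPower-unit {u} p∤u = exact u (sym (*-identityˡ u)) p∤u

  exactPower-^ : ∀ e → ExactPower p e (p ^ e)
  exactPower-^ e = exact 1 (sym (*-identityʳ (p ^ e))) p∤1

  exactPower-* : ∀ {e f a b} → ExactPower p e a → ExactPower p f b → ExactPower p (e + f) (a * b)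
  exactPower-* {e} {f} (exact u refl p∤u) (exact w refl p∤w) =
    exact (u * w) eq ([ p∤u , p∤w ]′ ∘ euclidsLemma u w p-prime)
    where
    eq : p ^ e * u * (p ^ f * w) ≡ p ^ (e + f) * (u * w)
    eq = begin
      p ^ e * u * (p ^ f * w)   ≡⟨ solve 4 (λ P u Q w → P :* u :* (Q :* w) := P :* Q :* (u :* w))
                                           refl (p ^ e) u (p ^ f) w ⟩
      p ^ e * p ^ f * (u * w)   ≡⟨ cong (_* (u * w)) (sym (^-distribˡ-+-* p e f)) ⟩
      p ^ (e + f) * (u * w)     ∎
      where open ≡-Reasoning

  exactPower-cancel : ∀ d {x w u} → p ∤ w → p ∤ u → x * w ≡ p ^ d * u → ExactPower p d x
  exactPower-cancel zero {x} {w} {u} p∤w p∤u x*w≡1*u = exact x (sym (*-identityˡ x))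
    (λ p∣x → p∤u (subst (p ∣_) (trans x*w≡1*u (*-identityˡ u)) (∣m⇒∣m*n w p∣x)))
  exactPower-cancel (suc d) {x} {w} {u} p∤w p∤u x*w≡p^[1+d]*u
    with euclidsLemma x w p-prime (divides (p ^ d * u) (trans x*w≡p^[1+d]*u
           (solve 3 (λ p P u → p :* P :* u := P :* u :* p) refl p (p ^ d) u)))
  ... | inj₂ p∣w = contradiction p∣w p∤w
  ... | inj₁ (divides y refl) = times-p (exactPower-cancel d p∤w p∤u y*w≡p^d*u)
    where
    open ≡-Reasoning
    y*w≡p^d*u : y * w ≡ p ^ d * u
    y*w≡p^d*u = *-cancelˡ-≡ (y * w) (p ^ d * u) p (begin
      p * (y * w)     ≡⟨ solve 3 (λ p y w → p :* (y :* w) := y :* p :* w) refl p y w ⟩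
      y * p * w       ≡⟨ x*w≡p^[1+d]*u ⟩
      p * p ^ d * u   ≡⟨ *-assoc p (p ^ d) u ⟩
      p * (p ^ d * u) ∎)
    times-p : ExactPower p d y → ExactPower p (suc d) (y * p)
    times-p (exact v refl p∤v) =
      exact v (solve 3 (λ P v p → P :* v :* p := p :* P :* v) refl (p ^ d) v p) p∤v

  exactPower-÷ : ∀ {f d x y} → ExactPower p (f + d) (x * y) → ExactPower p f y → ExactPower p d x
  exactPower-÷ {f} {d} {x} (exact u x*y≡ p∤u) (exact w refl p∤w) =
    exactPower-cancel d p∤w p∤u (*-cancelˡ-≡ (x * w) (p ^ d * u) (p ^ f) {{m^n≢0 p f}} (begin
      p ^ f * (x * w)     ≡⟨ solve 3 (λ P x w → P :* (x :* w) := x :* (P :* w)) refl (p ^ f) x w ⟩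
      x * (p ^ f * w)     ≡⟨ x*y≡ ⟩
      p ^ (f + d) * u     ≡⟨ cong (_* u) (^-distribˡ-+-* p f d) ⟩
      p ^ f * p ^ d * u   ≡⟨ *-assoc (p ^ f) (p ^ d) u ⟩
      p ^ f * (p ^ d * u) ∎))
    where open ≡-Reasoning

  p∤[m+k]P′k : ∀ {m} k → p ∣ m → k < p → p ∤ (m + k) P′ k
  p∤[m+k]P′k zero p∣m _ = p∤1
  p∤[m+k]P′k {m} (suc k) p∣m 1+k<p p∣P′
    with euclidsLemma (m + suc k) ((m + k) P′ k) p-prime
           (subst (p ∣_) ([m+1+k]P′[1+k]≡[m+1+k]*[m+k]P′k m k) p∣P′)
  ... | inj₁ p∣m+1+k = ∣⇒∤+ p∣m z<s 1+k<p p∣m+1+k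
  ... | inj₂ p∣P′k   = p∤[m+k]P′k k p∣m (<-trans (n<1+n k) 1+k<p) p∣P′k

  -- (p * (1 + M))! = p * (1 + M) · (p * M + 1)⋯(p * M + p ∸ 1) · (p * M)!
  [p*M]!-factorisation : ∀ M → ∃[ U ] (p * M) ! ≡ p ^ M * M ! * U × p ∤ U
  [p*M]!-factorisation zero = 1 , cong _! (*-zeroʳ p) , p∤1
  [p*M]!-factorisation (suc M) with [p*M]!-factorisation M
  ... | U , [p*M]!≡ , p∤U = R * U , eq , [ p∤R , p∤U ]′ ∘ euclidsLemma R U p-prime
    where
    open ≡-Reasoning
    k = pred p
    R = (p * M + k) P′ k
    p∤R : p ∤ R
    p∤R = p∤[m+k]P′k k (m∣m*n M) (subst (k <_) (suc-pred p) (n<1+n k))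
    p*[1+M]≡1+p*M+k : p * suc M ≡ suc (p * M + k)
    p*[1+M]≡1+p*M+k = begin
      p * suc M     ≡⟨ *-suc p M ⟩
      p + p * M     ≡⟨ +-comm p (p * M) ⟩
      p * M + p     ≡⟨ cong (p * M +_) (sym (suc-pred p)) ⟩
      p * M + suc k ≡⟨ +-suc (p * M) k ⟩
      suc (p * M + k) ∎
    eq : (p * suc M) ! ≡ p ^ suc M * suc M ! * (R * U)
    eq = begin
      (p * suc M) !                       ≡⟨ cong _! p*[1+M]≡1+p*M+k ⟩
      suc (p * M + k) * (p * M + k) !
        ≡⟨ cong₂ _*_ (sym p*[1+M]≡1+p*M+k) ([m+k]!≡[m+k]P′k*m! (p * M) k) ⟩
      p * suc M * (R * (p * M) !)         ≡⟨ cong (λ x → p * suc M * (R * x)) [p*M]!≡ ⟩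
      p * suc M * (R * (p ^ M * M ! * U))
        ≡⟨ solve 6 (λ p s r P f u → p :* s :* (r :* (P :* f :* u)) := p :* P :* (s :* f) :* (r :* u))
                   refl p (suc M) R (p ^ M) (M !) U ⟩
      p * p ^ M * (suc M * M !) * (R * U) ∎

  exactPower-[p*M]! : ∀ {e} M → ExactPower p e (M !) → ExactPower p (M + e) ((p * M) !)
  exactPower-[p*M]! {e} M M!-exact with [p*M]!-factorisation M
  ... | U , [p*M]!≡ , p∤U = subst₂ (ExactPower p) (+-identityʳ (M + e)) (sym [p*M]!≡)
        (exactPower-* (exactPower-* (exactPower-^ M) M!-exact) (exactPower-unit p∤U))

  exactPower-[c*p^n]! : ∀ {c} n → c < p → ExactPower p (c * geomSum p n) ((c * p ^ n) !)
  exactPower-[c*p^n]! {c} zero c<p =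
    subst₂ (ExactPower p) (sym (*-zeroʳ c)) (cong _! (sym (*-identityʳ c)))
      (exactPower-unit (subst (p ∤_) (nP′n≡n! c) (p∤[m+k]P′k c (p ∣0) c<p)))
  exactPower-[c*p^n]! {c} (suc n) c<p =
    subst₂ (ExactPower p) (sym (*-distribˡ-+ c (p ^ n) (geomSum p n)))
      (cong _! (solve 3 (λ p c P → p :* (c :* P) := c :* (p :* P)) refl p c (p ^ n)))
      (exactPower-[p*M]! (c * p ^ n) (exactPower-[c*p^n]! n c<p))

  exactPower-[m+k]P′k : ∀ {f d} m k → ExactPower p (f + d) ((m + k) !) → ExactPower p f (m !) →
                        ExactPower p d ((m + k) P′ k)
  exactPower-[m+k]P′k m k [m+k]!-exact =
    exactPower-÷ (subst (ExactPower p _) ([m+k]!≡[m+k]P′k*m! m k) [m+k]!-exact)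

  exactPower-[1+m]! : ∀ {e m} → p ∣ m → ExactPower p e (m !) → ExactPower p e (suc m !)
  exactPower-[1+m]! {m = m} p∣m =
    exactPower-* (exactPower-unit (subst (p ∤_) (+-comm m 1) (∣⇒∤+ p∣m z<s 1<p)))

  exactPower-[1+q+q]P′q : 2 < p → ∀ {n} → n ≥ 1 →
                          ExactPower p (geomSum p n) ((suc (p ^ n) + p ^ n) P′ (p ^ n))
  exactPower-[1+q+q]P′q 2<p {n} n≥1 = exactPower-[m+k]P′k (suc q) q [1+q+q]!-exact [1+q]!-exact
    where
    q = p ^ n
    G = geomSum p n
    2*m≡m+m : ∀ m → 2 * m ≡ m + m
    2*m≡m+m m = cong (m +_) (+-identityʳ m)
    p∣q : p ∣ q
    p∣q = subst (_∣ q) (*-identityʳ p) (^-monoʳ-∣ p n≥1)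
    [1+q]!-exact : ExactPower p G (suc q !)
    [1+q]!-exact = exactPower-[1+m]! p∣q
      (subst₂ (ExactPower p) (*-identityˡ G) (cong _! (*-identityˡ q)) (exactPower-[c*p^n]! n 1<p))
    [1+q+q]!-exact : ExactPower p (G + G) (suc (q + q) !)
    [1+q+q]!-exact = exactPower-[1+m]! (∣m∣n⇒∣m+n p∣q p∣q)
      (subst₂ (ExactPower p) (2*m≡m+m G) (cong _! (2*m≡m+m q)) (exactPower-[c*p^n]! n 2<p))

singleSegment-criterion : ∀ {p k a y₀} → Valuation p (a 0) y₀ → Valuation p (a k) 0 →
  (∀ i → i ≤ k → ∃[ E ] p ^ E ∣ a i × y₀ * (k ∸ i) ≤ k * E) →
  NewtonPolygonSingleSegment p k a y₀
singleSegment-criterion {k = k} a₀-val aₖ-val bound = a₀-val , aₖ-val , λ i e i≤k aᵢ-val →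
  let E , p^E∣aᵢ , y₀[k∸i]≤kE = bound i i≤k
  in ≤-trans y₀[k∸i]≤kE (*-monoʳ-≤ k (valuation⇒≤ aᵢ-val p^E∣aᵢ))

lemma2p14 : (p n : ℕ) → Prime p → p ≢ 2 → n ≥ 1 →
    NewtonPolygonSingleSegment p (p ^ n) (P-coeff (p ^ n) (p ^ n + 1)) (geomQuot p n)
lemma2p14 p n p-prime p≢2 n≥1 =
  subst (NewtonPolygonSingleSegment p q a) (sym (geomQuot≡geomSum n (1<p p-prime)))
    (singleSegment-criterion {y₀ = geomSum p n} a₀-valuation a_q-valuation aᵢ-bound)
  where
  q = p ^ n
  a = P-coeff q (q + 1)
  2<p : 2 < p
  2<p = ≤∧≢⇒< (1<p p-prime) (p≢2 ∘ sym)
  a₀≡[1+q+q]P′q : a 0 ≡ (suc q + q) P′ q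
  a₀≡[1+q+q]P′q = trans (P-coeff-0 q (q + 1)) (cong (λ m → (m + q) P′ q) (+-comm q 1))
  a₀-valuation : Valuation p (a 0) (geomSum p n)
  a₀-valuation = exactPower⇒valuation p-prime
    (subst (ExactPower p _) (sym a₀≡[1+q+q]P′q) (exactPower-[1+q+q]P′q p-prime 2<p n≥1))
  a_q-valuation : Valuation p (a q) 0
  a_q-valuation = subst (λ m → Valuation p m 0) (sym (P-coeff-top q (q + 1)))
    (exactPower⇒valuation p-prime (exactPower-unit p-prime (p∤1 p-prime)))
  aᵢ-bound : ∀ i → i ≤ q → ∃[ E ] p ^ E ∣ a i × geomSum p n * (q ∸ i) ≤ q * E
  aᵢ-bound i i≤q with [p^n]P′j-valuation-lowerBound p {{prime⇒nonZero p-prime}} n (q ∸ i)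
  ... | E , p^E∣ , [q∸i]*G≤q*E =
    E , ∣-trans p^E∣ (uP′[u∸i]∣P-coeff (q + 1) i≤q) ,
    ≤-trans (≤-reflexive (*-comm (geomSum p n) (q ∸ i))) [q∸i]*G≤q*E
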